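{- For positive integers $k,q,m$ with $q<k$, one has $\alpha^k_{q,m}=0$; that is, there is no M-partition of type $(k,q,m)$ when $q<k$.
   Context: Let $\mathbb{N}=\{0,1,2,\dots\}$ with $\mathbb{N}^n$ ordered componentwise. An $(n-1)$-dimensional partition of size $d$ is a set $\lambda\subset\mathbb{N}^n$ of $d$ points, downward closed for the componentwise order; $\mathrm P^n_d$ is the set of these. The degree of a point is the sum of its coordinates; $h_\lambda(i)$ is the number of points of degree $i$; $\lambda_{\geqslant3}$ is the set of points of degree $\geqslant3$; $\mathrm{Soc}(\lambda)$ is the set of maximal elements of $\lambda$. For positive integers $k,q,m$, an M-partition of type $(k,q,m)$ is a $\lambda\in\mathrm P^k_{1+k+q+m}$ with $\mathrm{Soc}(\lambda)\subset\lambda_{\geqslant3}$, $h_\lambda(1)=k$, $h_\lambda(2)=q$ and $\sum_{i\geqslant3}h_\lambda(i)=m$; $\alpha^k_{q,m}$ denotes their number. -}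

module Defs where

open import Data.Nat using (ℕ; _≤_; _≟_; _≤?_; _+_)
open import Data.Vec using (Vec)
open import Data.Vec.Relation.Binary.Pointwise.Inductive using (Pointwise)
open import Data.List using (List; length; filter)
open import Data.List.Membership.Propositional using (_∈_)
open import Data.List.Relation.Unary.Unique.Propositional using (Unique)
open import Relation.Binary.PropositionalEquality using (_≡_)
open import Data.Product using (_×_)
import Data.Vec as V

Point : ℕ → Set
Point n = Vec ℕ n

_≼_ : ∀ {n} → Point n → Point n → Set
_≼_ = Pointwise _≤_

deg : ∀ {n} → Point n → ℕ
deg = V.sum

record IsPartition (n d : ℕ) (lam : List (Point n)) : Set where
  field
    unique     : Unique lam
    size       : length lam ≡ d
    downClosed : ∀ {p r} → p ∈ lam → r ≼ p → r ∈ lam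

h : ∀ {n} → List (Point n) → ℕ → ℕ
h lam i = length (filter (λ p → deg p ≟ i) lam)

hGe3 : ∀ {n} → List (Point n) → ℕ
hGe3 lam = length (filter (λ p → 3 ≤? deg p) lam)

InSoc : ∀ {n} → List (Point n) → Point n → Set
InSoc lam p = p ∈ lam × (∀ {r} → r ∈ lam → p ≼ r → r ≡ p)

record IsMPartition (k q m : ℕ) (lam : List (Point k)) : Set where
  field
    partition : IsPartition k (1 + k + q + m) lam
    socGe3    : ∀ {p} → InSoc lam p → 3 ≤ deg p
    h1        : h lam 1 ≡ k
    h2        : h lam 2 ≡ q
    hRest     : hGe3 lam ≡ m

-- Double counting. Read the degree-2 points of λ as a graph on the vertices 1 … k: a loop 2eᵢ
-- at i and an edge eᵢ + eⱼ between i ≠ j. A loop sends charge 2 to its vertex; an edge sends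
-- nothing to a looped endpoint, 2 to an unlooped endpoint whose partner is looped, and 1 to
-- each endpoint if neither is looped. So every degree-2 point emits at most 2. Since no point
-- of degree < 3 is maximal in λ, every vertex i with eᵢ ∈ λ receives at least 2: an unlooped i
-- lies on an edge eᵢ + eⱼ, and if j is unlooped as well, that edge lies below some
-- eᵢ + eⱼ + eₗ ∈ λ with l ∉ {i, j}, which yields a second edge eᵢ + eₗ at i. As h(1) = k forces
-- all eᵢ into λ, this gives 2k ≤ 2q.
module Submission where

open import Defs
open import Data.Nat using (ℕ; _<_)
open import Data.List using (List)
open import Relation.Nullary using (¬_)

open import Data.Nat using (zero; suc; _+_; _*_; _≤_; _≟_; _≤?_; z≤n; s≤s)
open import Data.Bool using (Bool; true; false)
open import Data.Fin using (Fin; zero; suc)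
import Data.Fin.Properties as Fin
open import Data.List using ([]; _∷_; _++_; filter; length; map; allFin)
open import Data.List.Membership.Propositional using (_∈_; find; lose)
open import Data.List.Membership.Propositional.Properties
  using (∈-∃++; ∈-++⁻; ∈-++⁺ˡ; ∈-++⁺ʳ; ∈-allFin; ∈-filter⁺; ∈-filter⁻; ∈-map⁺)
import Data.Vec.Properties as VecP
open import Data.List.Properties using (length-map)
open import Data.List.Relation.Unary.All as All using ([]; _∷_)
open import Data.List.Relation.Unary.AllPairs using ([]; _∷_)
open import Data.List.Relation.Unary.Any using (here; there; any?)
open import Data.List.Relation.Unary.Unique.Propositional using (Unique)
open import Data.List.Relation.Unary.Unique.Propositional.Properties using (allFin⁺; filter⁺)
open import Data.Nat.Properties
open import Algebra.Properties.CommutativeSemigroup +-commutativeSemigroup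
  using (x∙yz≈y∙xz; interchange)
open import Data.Product using (∃; ∃₂; _×_; _,_; proj₂)
open import Data.Sum using (inj₁; inj₂)
open import Data.Vec using ([]; _∷_; lookup; replicate; _[_]%=_)
import Data.Vec.Relation.Binary.Pointwise.Inductive as Pointwise
open Pointwise using ([]; _∷_)
open import Function using (_∘_; const)
open import Relation.Nullary using (Dec; yes; no; does; contradiction; ¬?)
open import Relation.Nullary.Decidable using (_×-dec_; dec-true; dec-false; decidable-stable)
open import Relation.Binary.PropositionalEquality

∑ : {A : Set} → (A → ℕ) → List A → ℕ
∑ f []       = 0
∑ f (x ∷ xs) = f x + ∑ f xs

module _ {A : Set} (f : A → ℕ) where

  ∑-++-∷ : ∀ xs {x} ys → ∑ f (xs ++ x ∷ ys) ≡ f x + ∑ f (xs ++ ys)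
  ∑-++-∷ []       ys = refl
  ∑-++-∷ (y ∷ xs) {x} ys = trans (cong (f y +_) (∑-++-∷ xs ys)) (x∙yz≈y∙xz (f y) (f x) _)

  ∑-mono-⊆ : ∀ {xs ys} → Unique xs → (∀ {x} → x ∈ xs → f x ≢ 0 → x ∈ ys) →
             ∑ f xs ≤ ∑ f ys
  ∑-mono-⊆ {[]}     _           _   = z≤n
  ∑-mono-⊆ {x ∷ xs} (x∉xs ∷ xs!) sub with f x ≟ 0
  ... | yes fx≡0 rewrite fx≡0 = ∑-mono-⊆ xs! (sub ∘ there)
  ... | no fx≢0 with ∈-∃++ (sub (here refl) fx≢0)
  ...   | ys₁ , ys₂ , refl = begin
    f x + ∑ f xs            ≤⟨ +-monoʳ-≤ (f x) (∑-mono-⊆ xs! sub′) ⟩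
    f x + ∑ f (ys₁ ++ ys₂)  ≡⟨ ∑-++-∷ ys₁ ys₂ ⟨
    ∑ f (ys₁ ++ x ∷ ys₂)    ∎
    where
    open ≤-Reasoning
    sub′ : ∀ {y} → y ∈ xs → f y ≢ 0 → y ∈ ys₁ ++ ys₂
    sub′ y∈xs fy≢0 with ∈-++⁻ ys₁ (sub (there y∈xs) fy≢0)
    ... | inj₁ y∈ys₁         = ∈-++⁺ˡ y∈ys₁
    ... | inj₂ (here refl)   = contradiction refl (All.lookup x∉xs y∈xs)
    ... | inj₂ (there y∈ys₂) = ∈-++⁺ʳ ys₁ y∈ys₂

  ∑-≥-∈ : ∀ {x xs} → x ∈ xs → f x ≤ ∑ f xs
  ∑-≥-∈ {xs = y ∷ _} (here refl) = m≤m+n (f y) _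
  ∑-≥-∈ {xs = y ∷ _} (there x∈)  = ≤-trans (∑-≥-∈ x∈) (m≤n+m _ (f y))

  ∑-≥-pair : ∀ {x y xs} → Unique xs → x ∈ xs → y ∈ xs → x ≢ y → f x + f y ≤ ∑ f xs
  ∑-≥-pair {x} {y} {xs} xs! x∈ y∈ x≢y =
    subst (_≤ ∑ f xs) (cong (f x +_) (+-identityʳ (f y))) (∑-mono-⊆ ((x≢y ∷ []) ∷ [] ∷ []) sub)
    where
    sub : ∀ {z} → z ∈ x ∷ y ∷ [] → f z ≢ 0 → z ∈ xs
    sub (here refl)         _ = x∈
    sub (there (here refl)) _ = y∈

module _ {A : Set} where

  ∑-mono : ∀ {f g : A → ℕ} xs → (∀ {x} → x ∈ xs → f x ≤ g x) → ∑ f xs ≤ ∑ g xs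
  ∑-mono []       _   = z≤n
  ∑-mono (x ∷ xs) f≤g = +-mono-≤ (f≤g (here refl)) (∑-mono xs (f≤g ∘ there))

  ∑-const : ∀ c (xs : List A) → ∑ (const c) xs ≡ c * length xs
  ∑-const c []       = sym (*-zeroʳ c)
  ∑-const c (x ∷ xs) = trans (cong (c +_) (∑-const c xs)) (sym (*-suc c (length xs)))

  ∑-+ : ∀ (f g : A → ℕ) xs → ∑ (λ x → f x + g x) xs ≡ ∑ f xs + ∑ g xs
  ∑-+ f g []       = refl
  ∑-+ f g (x ∷ xs) =
    trans (cong (f x + g x +_) (∑-+ f g xs)) (interchange (f x) (g x) (∑ f xs) (∑ g xs))

  length-mono-⊆ : ∀ {xs ys : List A} → Unique xs → (∀ {x} → x ∈ xs → x ∈ ys) →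
                  length xs ≤ length ys
  length-mono-⊆ {xs} {ys} xs! sub =
    subst₂ _≤_ (length≡∑ xs) (length≡∑ ys) (∑-mono-⊆ (const 1) xs! (λ x∈ _ → sub x∈))
    where
    length≡∑ : ∀ zs → ∑ (const 1) zs ≡ length zs
    length≡∑ zs = trans (∑-const 1 zs) (*-identityˡ (length zs))

∑-swap : ∀ {A B : Set} (g : A → B → ℕ) (xs : List A) (ys : List B) →
         ∑ (λ x → ∑ (g x) ys) xs ≡ ∑ (λ y → ∑ (λ x → g x y) xs) ys
∑-swap g []       ys = sym (∑-const 0 ys)
∑-swap g (x ∷ xs) ys =
  trans (cong (∑ (g x) ys +_) (∑-swap g xs ys)) (sym (∑-+ (g x) (λ y → ∑ (λ x → g x y) xs) ys))

module _ {n : ℕ} where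

  𝟎 : Point n
  𝟎 = replicate n 0

  infixl 25 _+e_

  _+e_ : Point n → Fin n → Point n
  p +e j = p [ j ]%= suc

  e : Fin n → Point n
  e i = 𝟎 +e i

  lookup-𝟎 : ∀ i → lookup 𝟎 i ≡ 0
  lookup-𝟎 i = VecP.lookup-replicate i 0

  lookup-+e-≡ : ∀ p j → lookup (p +e j) j ≡ suc (lookup p j)
  lookup-+e-≡ p j = VecP.lookup∘updateAt j p

  lookup-+e-≢ : ∀ p {i j} → i ≢ j → lookup (p +e j) i ≡ lookup p i
  lookup-+e-≢ p {i} {j} i≢j = VecP.lookup∘updateAt′ i j i≢j p

  lookup-e-≢ : ∀ i {l} → l ≢ i → lookup (e i) l ≡ 0
  lookup-e-≢ i {l} l≢i = trans (lookup-+e-≢ 𝟎 l≢i) (lookup-𝟎 l)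

  lookup-e-≡ : ∀ i → lookup (e i) i ≡ 1
  lookup-e-≡ i = trans (lookup-+e-≡ 𝟎 i) (cong suc (lookup-𝟎 i))

  lookup-loop-≡ : ∀ i → lookup (e i +e i) i ≡ 2
  lookup-loop-≡ i = trans (lookup-+e-≡ (e i) i) (cong suc (lookup-e-≡ i))

  lookup-loop-≢ : ∀ i {l} → l ≢ i → lookup (e i +e i) l ≡ 0
  lookup-loop-≢ i l≢i = trans (lookup-+e-≢ (e i) l≢i) (lookup-e-≢ i l≢i)

  lookup-edge-left : ∀ {i j} → i ≢ j → lookup (e i +e j) i ≡ 1
  lookup-edge-left {i} i≢j = trans (lookup-+e-≢ (e i) i≢j) (lookup-e-≡ i)

  lookup-edge-right : ∀ {i j} → i ≢ j → lookup (e i +e j) j ≡ 1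
  lookup-edge-right {i} {j} i≢j = trans (lookup-+e-≡ (e i) j) (cong suc (lookup-e-≢ i (i≢j ∘ sym)))

  lookup-edge-outside : ∀ {i j l} → l ≢ i → l ≢ j → lookup (e i +e j) l ≡ 0
  lookup-edge-outside {i} l≢i l≢j = trans (lookup-+e-≢ (e i) l≢j) (lookup-e-≢ i l≢i)

deg-𝟎 : ∀ n → deg (𝟎 {n}) ≡ 0
deg-𝟎 zero    = refl
deg-𝟎 (suc n) = deg-𝟎 n

deg-+e : ∀ {n} (p : Point n) j → deg (p +e j) ≡ suc (deg p)
deg-+e (x ∷ p) zero    = refl
deg-+e (x ∷ p) (suc j) = trans (cong (x +_) (deg-+e p j)) (+-suc x (deg p))

deg-e : ∀ {n} (i : Fin n) → deg (e i) ≡ 1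
deg-e {n} i = trans (deg-+e 𝟎 i) (cong suc (deg-𝟎 n))

deg-e+e : ∀ {n} (i j : Fin n) → deg (e i +e j) ≡ 2
deg-e+e i j = trans (deg-+e (e i) j) (cong suc (deg-e i))

deg≡0⇒𝟎 : ∀ {n} (p : Point n) → deg p ≡ 0 → p ≡ 𝟎
deg≡0⇒𝟎 []         _  = refl
deg≡0⇒𝟎 (zero ∷ p) d≡0 = cong (0 ∷_) (deg≡0⇒𝟎 p d≡0)

deg≡suc⇒+e : ∀ {n d} (p : Point n) → deg p ≡ suc d → ∃₂ λ q j → deg q ≡ d × p ≡ q +e j
deg≡suc⇒+e (zero ∷ p) d≡ with deg≡suc⇒+e p d≡
... | q , j , deg-q , refl = 0 ∷ q , suc j , deg-q , refl
deg≡suc⇒+e (suc x ∷ p) d≡ = x ∷ p , zero , suc-injective d≡ , refl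

deg≡1⇒e : ∀ {n} (p : Point n) → deg p ≡ 1 → ∃ λ i → p ≡ e i
deg≡1⇒e p d≡1 with deg≡suc⇒+e p d≡1
... | q , i , deg-q , refl rewrite deg≡0⇒𝟎 q deg-q = i , refl

deg≡2⇒e+e : ∀ {n} (p : Point n) → deg p ≡ 2 → ∃₂ λ i j → p ≡ e i +e j
deg≡2⇒e+e p d≡2 with deg≡suc⇒+e p d≡2
... | q , j , deg-q , refl with deg≡1⇒e q deg-q
...   | i , refl = i , j , refl

𝟎-≼ : ∀ {n} (p : Point n) → 𝟎 ≼ p
𝟎-≼ []      = []
𝟎-≼ (x ∷ p) = z≤n ∷ 𝟎-≼ p

≼-+e : ∀ {n} (p : Point n) j → p ≼ p +e j
≼-+e (x ∷ p) zero    = n≤1+n x ∷ Pointwise.refl ≤-refl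
≼-+e (x ∷ p) (suc j) = ≤-refl ∷ ≼-+e p j

+e-mono-≼ : ∀ {n} {p q : Point n} j → p ≼ q → p +e j ≼ q +e j
+e-mono-≼ zero    (x≤y ∷ p≼q) = s≤s x≤y ∷ p≼q
+e-mono-≼ (suc j) (x≤y ∷ p≼q) = x≤y ∷ +e-mono-≼ j p≼q

≺⇒+e-≼ : ∀ {n} {p q : Point n} → p ≼ q → p ≢ q → ∃ λ j → p +e j ≼ q
≺⇒+e-≼ []                p≢q = contradiction refl p≢q
≺⇒+e-≼ {p = x ∷ _} (x≤y ∷ p≼q) p≢q with m≤n⇒m<n∨m≡n x≤y
... | inj₁ x<y  = zero , x<y ∷ p≼q
... | inj₂ refl with ≺⇒+e-≼ p≼q (p≢q ∘ cong (x ∷_))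
...   | j , le = suc j , ≤-refl ∷ le

_≟ᵖ_ : ∀ {n} (p q : Point n) → Dec (p ≡ q)
_≟ᵖ_ = VecP.≡-dec _≟_

_≼?_ : ∀ {n} (p q : Point n) → Dec (p ≼ q)
_≼?_ = Pointwise.decidable _≤?_

_∈?_ : ∀ {n} (p : Point n) (ps : List (Point n)) → Dec (p ∈ ps)
p ∈? ps = any? (p ≟ᵖ_) ps

module Charging {k : ℕ} (lam : List (Point k)) where

  Looped : Fin k → Set
  Looped i = e i +e i ∈ lam

  looped? : ∀ i → Dec (Looped i)
  looped? i = (e i +e i) ∈? lam

  TouchesLoop : Point k → Set
  TouchesLoop p = ∃ λ j → 1 ≤ lookup p j × Looped j

  touchesLoop? : ∀ p → Dec (TouchesLoop p)
  touchesLoop? p = Fin.any? (λ j → (1 ≤? lookup p j) ×-dec looped? j)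

  -- For an edge eᵢ + eⱼ and an unlooped i, touching a loop means that j is looped.
  chargeOf : ℕ → Bool → Bool → ℕ
  chargeOf 2 _     _     = 2
  chargeOf 1 true  _     = 0
  chargeOf 1 false true  = 2
  chargeOf 1 false false = 1
  chargeOf _ _     _     = 0

  charge : Point k → Fin k → ℕ
  charge p i = chargeOf (lookup p i) (does (looped? i)) (does (touchesLoop? p))

  charge≤2 : ∀ p i → charge p i ≤ 2
  charge≤2 p i = chargeOf≤2 (lookup p i) _ _
    where
    chargeOf≤2 : ∀ x a b → chargeOf x a b ≤ 2
    chargeOf≤2 0                 _     _     = z≤n
    chargeOf≤2 1                 true  _     = z≤n
    chargeOf≤2 1                 false true  = ≤-refl
    chargeOf≤2 1                 false false = s≤s z≤n
    chargeOf≤2 2                 _     _     = ≤-refl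
    chargeOf≤2 (suc (suc (suc x))) _   _     = z≤n

  charge-0 : ∀ p {i} → lookup p i ≡ 0 → charge p i ≡ 0
  charge-0 p p≡0 rewrite p≡0 = refl

  charge-2 : ∀ p {i} → lookup p i ≡ 2 → charge p i ≡ 2
  charge-2 p p≡2 rewrite p≡2 = refl

  charge-looped : ∀ p {i} → lookup p i ≡ 1 → Looped i → charge p i ≡ 0
  charge-looped p {i} p≡1 l rewrite p≡1 | dec-true (looped? i) l = refl

  charge-touching : ∀ p {i} → lookup p i ≡ 1 → ¬ Looped i → TouchesLoop p → charge p i ≡ 2
  charge-touching p {i} p≡1 ¬l t
    rewrite p≡1 | dec-false (looped? i) ¬l | dec-true (touchesLoop? p) t = refl

  charge-lonely : ∀ p {i} → lookup p i ≡ 1 → ¬ Looped i → ¬ TouchesLoop p → charge p i ≡ 1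
  charge-lonely p {i} p≡1 ¬l ¬t
    rewrite p≡1 | dec-false (looped? i) ¬l | dec-false (touchesLoop? p) ¬t = refl

  charge≥1 : ∀ p {i} → lookup p i ≡ 1 → ¬ Looped i → 1 ≤ charge p i
  charge≥1 p {i} p≡1 ¬l
    rewrite p≡1 | dec-false (looped? i) ¬l with does (touchesLoop? p)
  ... | true  = s≤s z≤n
  ... | false = s≤s z≤n

  charge-edge : ∀ {a b} → a ≢ b → charge (e a +e b) a + charge (e a +e b) b ≤ 2
  charge-edge {a} {b} a≢b = bound (looped? a) (looped? b)
    where
    p = e a +e b
    bound : Dec (Looped a) → Dec (Looped b) → charge p a + charge p b ≤ 2
    bound (yes la) _ = begin
      charge p a + charge p b ≡⟨ cong (_+ charge p b) (charge-looped p (lookup-edge-left a≢b) la) ⟩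
      charge p b              ≤⟨ charge≤2 p b ⟩
      2                       ∎
      where open ≤-Reasoning
    bound (no ¬la) (yes lb) = begin
      charge p a + charge p b ≡⟨ cong (charge p a +_) (charge-looped p (lookup-edge-right a≢b) lb) ⟩
      charge p a + 0          ≡⟨ +-identityʳ (charge p a) ⟩
      charge p a              ≤⟨ charge≤2 p a ⟩
      2                       ∎
      where open ≤-Reasoning
    bound (no ¬la) (no ¬lb) =
      ≤-reflexive (cong₂ _+_ (charge-lonely p (lookup-edge-left a≢b) ¬la ¬t)
                             (charge-lonely p (lookup-edge-right a≢b) ¬lb ¬t))
      where
      ¬t : ¬ TouchesLoop p
      ¬t (j , 1≤pj , lj) with j Fin.≟ a | j Fin.≟ b
      ... | yes refl | _        = ¬la lj
      ... | no _     | yes refl = ¬lb lj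
      ... | no j≢a   | no j≢b   = contradiction (subst (1 ≤_) (lookup-edge-outside j≢a j≢b) 1≤pj) λ ()

  charge-loop-total : ∀ a → ∑ (charge (e a +e a)) (allFin k) ≤ 2
  charge-loop-total a = begin
    ∑ (charge p) (allFin k)  ≤⟨ ∑-mono-⊆ (charge p) (allFin⁺ k) support ⟩
    charge p a + 0           ≡⟨ +-identityʳ (charge p a) ⟩
    charge p a               ≤⟨ charge≤2 p a ⟩
    2                        ∎
    where
    open ≤-Reasoning
    p = e a +e a
    support : ∀ {x} → x ∈ allFin k → charge p x ≢ 0 → x ∈ a ∷ []
    support {x} _ c≢0 with x Fin.≟ a
    ... | yes refl = here refl
    ... | no x≢a   = contradiction (charge-0 p (lookup-loop-≢ a x≢a)) c≢0

  charge-edge-total : ∀ {a b} → a ≢ b → ∑ (charge (e a +e b)) (allFin k) ≤ 2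
  charge-edge-total {a} {b} a≢b = begin
    ∑ (charge p) (allFin k)       ≤⟨ ∑-mono-⊆ (charge p) (allFin⁺ k) support ⟩
    charge p a + (charge p b + 0) ≡⟨ cong (charge p a +_) (+-identityʳ (charge p b)) ⟩
    charge p a + charge p b       ≤⟨ charge-edge a≢b ⟩
    2                             ∎
    where
    open ≤-Reasoning
    p = e a +e b
    support : ∀ {x} → x ∈ allFin k → charge p x ≢ 0 → x ∈ a ∷ b ∷ []
    support {x} _ c≢0 with x Fin.≟ a | x Fin.≟ b
    ... | yes refl | _        = here refl
    ... | no _     | yes refl = there (here refl)
    ... | no x≢a   | no x≢b   = contradiction (charge-0 p (lookup-edge-outside x≢a x≢b)) c≢0

  charge-total≤2 : ∀ p → deg p ≡ 2 → ∑ (charge p) (allFin k) ≤ 2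
  charge-total≤2 p deg≡2 with deg≡2⇒e+e p deg≡2
  ... | a , b , refl with a Fin.≟ b
  ...   | yes refl = charge-loop-total a
  ...   | no a≢b   = charge-edge-total a≢b

module _ {k q m : ℕ} {lam : List (Point k)} (M : IsMPartition k q m lam) where
  open IsMPartition M
  open IsPartition partition
  open Charging lam

  upper-cover : ∀ {p} → p ∈ lam → deg p < 3 → ∃ λ j → p +e j ∈ lam
  upper-cover {p} p∈ deg<3 with any? (λ r → (p ≼? r) ×-dec ¬? (r ≟ᵖ p)) lam
  ... | yes above with find above
  ...   | r , r∈ , p≼r , r≢p with ≺⇒+e-≼ p≼r (r≢p ∘ sym)
  ...     | j , p+ej≼r = j , downClosed r∈ p+ej≼r
  upper-cover {p} p∈ deg<3 | no ¬above = contradiction (socGe3 (p∈ , maximal)) (<⇒≱ deg<3)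
    where
    maximal : ∀ {r} → r ∈ lam → p ≼ r → r ≡ p
    maximal r∈ p≼r = decidable-stable (_ ≟ᵖ p) (λ r≢p → ¬above (lose r∈ (p≼r , r≢p)))

  degree2 : List (Point k)
  degree2 = filter (λ p → deg p ≟ 2) lam

  ∈degree2⇒deg≡2 : ∀ {p} → p ∈ degree2 → deg p ≡ 2
  ∈degree2⇒deg≡2 = proj₂ ∘ ∈-filter⁻ (λ p → deg p ≟ 2) {xs = lam}

  received : Fin k → ℕ
  received i = ∑ (λ p → charge p i) degree2

  e+e∈degree2 : ∀ {i j} → e i +e j ∈ lam → e i +e j ∈ degree2
  e+e∈degree2 {i} {j} p∈ = ∈-filter⁺ (λ p → deg p ≟ 2) p∈ (deg-e+e i j)

  received-edge : ∀ {i j} → i ≢ j → ¬ Looped i → e i +e j ∈ lam → 2 ≤ received i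
  received-edge {i} {j} i≢j ¬li ij∈ with looped? j
  ... | yes lj = begin
    2                  ≡⟨ charge-touching (e i +e j) (lookup-edge-left i≢j) ¬li touches ⟨
    charge (e i +e j) i ≤⟨ ∑-≥-∈ (λ p → charge p i) (e+e∈degree2 ij∈) ⟩
    received i         ∎
    where
    open ≤-Reasoning
    touches = j , ≤-reflexive (sym (lookup-edge-right i≢j)) , lj
  ... | no ¬lj with upper-cover ij∈ (subst (_< 3) (sym (deg-e+e i j)) ≤-refl)
  ...   | l , ijl∈ with l Fin.≟ i | l Fin.≟ j
  ...     | yes refl | _        = contradiction (downClosed ijl∈ (+e-mono-≼ i (≼-+e (e i) j))) ¬li
  ...     | no _     | yes refl = contradiction (downClosed ijl∈ (+e-mono-≼ j (+e-mono-≼ j (𝟎-≼ (e i))))) ¬lj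
  ...     | no l≢i   | no l≢j   = begin
    1 + 1
      ≤⟨ +-mono-≤ (charge≥1 (e i +e j) (lookup-edge-left i≢j) ¬li)
                  (charge≥1 (e i +e l) (lookup-edge-left (l≢i ∘ sym)) ¬li) ⟩
    charge (e i +e j) i + charge (e i +e l) i
      ≤⟨ ∑-≥-pair (λ p → charge p i) (filter⁺ _ unique) (e+e∈degree2 ij∈) (e+e∈degree2 il∈) ij≢il ⟩
    received i
      ∎
    where
    open ≤-Reasoning
    il∈ : e i +e l ∈ lam
    il∈ = downClosed ijl∈ (+e-mono-≼ l (≼-+e (e i) j))
    ij≢il : e i +e j ≢ e i +e l
    ij≢il eq = 1+n≢0 (trans (sym (lookup-edge-right i≢j))
                            (trans (cong (λ v → lookup v j) eq) (lookup-edge-outside (i≢j ∘ sym) (l≢j ∘ sym))))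

  received≥2 : ∀ {i} → e i ∈ lam → 2 ≤ received i
  received≥2 {i} i∈ = by-loop (looped? i)
    where
    by-loop : Dec (Looped i) → 2 ≤ received i
    by-loop (yes li) = ≤-trans (≤-reflexive (sym (charge-2 (e i +e i) (lookup-loop-≡ i))))
                               (∑-≥-∈ (λ p → charge p i) (e+e∈degree2 li))
    by-loop (no ¬li) with upper-cover i∈ (subst (_< 3) (sym (deg-e i)) (s≤s (s≤s z≤n)))
    ... | j , ij∈ with i Fin.≟ j
    ...   | yes refl = contradiction ij∈ ¬li
    ...   | no i≢j   = received-edge i≢j ¬li ij∈

  vertices : List (Fin k)
  vertices = filter (λ i → e i ∈? lam) (allFin k)

  ∈vertices⇒e∈ : ∀ {i} → i ∈ vertices → e i ∈ lam
  ∈vertices⇒e∈ = proj₂ ∘ ∈-filter⁻ (λ i → e i ∈? lam) {xs = allFin k}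

  k≤|vertices| : k ≤ length vertices
  k≤|vertices| = begin
    k                      ≡⟨ h1 ⟨
    h lam 1                ≤⟨ length-mono-⊆ (filter⁺ _ unique) degree1⊆ ⟩
    length (map e vertices) ≡⟨ length-map e vertices ⟩
    length vertices        ∎
    where
    open ≤-Reasoning
    degree1⊆ : ∀ {p} → p ∈ filter (λ p → deg p ≟ 1) lam → p ∈ map e vertices
    degree1⊆ {p} p∈ with ∈-filter⁻ (λ p → deg p ≟ 1) p∈
    ... | p∈lam , deg≡1 with deg≡1⇒e p deg≡1
    ...   | i , refl = ∈-map⁺ e (∈-filter⁺ (λ i → e i ∈? lam) (∈-allFin i) p∈lam)

  k≤q : k ≤ q
  k≤q = *-cancelˡ-≤ 2 (begin
    2 * k                                      ≤⟨ *-monoʳ-≤ 2 k≤|vertices| ⟩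
    2 * length vertices                        ≡⟨ ∑-const 2 vertices ⟨
    ∑ (const 2) vertices                       ≤⟨ ∑-mono vertices (received≥2 ∘ ∈vertices⇒e∈) ⟩
    ∑ received vertices                        ≤⟨ ∑-mono-⊆ received (filter⁺ _ (allFin⁺ k)) (λ {i} _ _ → ∈-allFin i) ⟩
    ∑ received (allFin k)                      ≡⟨ ∑-swap (λ i p → charge p i) (allFin k) degree2 ⟩
    ∑ (λ p → ∑ (charge p) (allFin k)) degree2  ≤⟨ ∑-mono degree2 (λ {p} → charge-total≤2 p ∘ ∈degree2⇒deg≡2) ⟩
    ∑ (const 2) degree2                        ≡⟨ ∑-const 2 degree2 ⟩
    2 * length degree2                         ≡⟨ cong (2 *_) h2 ⟩
    2 * q                                      ∎)
    where open ≤-Reasoning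

proposition4p2 : (k q m : ℕ) → 0 < k → 0 < q → 0 < m → q < k →
    (lam : List (Point k)) → ¬ IsMPartition k q m lam
proposition4p2 k q m _ _ _ q<k lam M = <⇒≱ q<k (k≤q M)
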